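{- Let $Q$ be a unital quantale, $M$ a left $Q$-module, and $X\subseteq M$ a set of generators of $M$. Then $M$ is a projective object in the category of left $Q$-modules if and only if there exists $k\in Q^{X\times X}$ with $k\star k = k$ such that $M$ is isomorphic to the submodule of $Q^X$ generated by the functions $k(x,\_) \in Q^X$, $x\in X$.
   Context: A quantale is a complete lattice with an associative multiplication distributing over arbitrary joins in both arguments; unital if it has a multiplicative unit $1$. A left $Q$-module is a complete lattice $M$ with a scalar multiplication $\ast:Q\times M\to M$ such that $(ab)\ast v = a\ast(b\ast v)$, $1\ast v=v$, and $\ast$ distributes over arbitrary joins in both arguments; morphisms are join-preserving maps commuting with scalar multiplication. $Q^X$ denotes the module of functions $X\to Q$ with pointwise joins and scalar multiplication (the free left $Q$-module on $X$). For $k\in Q^{X\times X}$ and $x\in X$, $k(x,\_)$ is the function $y\mapsto k(x,y)$ in $Q^X$. The product on $Q^{X\times X}$ is $(h\star k)(x,y) = \bigvee_{z\in X} h(x,z)\cdot k(z,y)$. -}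

module Defs where

open import Data.Product using (Σ; _×_; _,_; proj₁; proj₂)
open import Function.Bundles using (_⇔_)

Eq≤ : {A : Set} → (A → A → Set) → A → A → Set
Eq≤ _≤_ a b = (a ≤ b) × (b ≤ a)

-- A complete lattice is presented by its order and
-- arbitrary joins ⋁ over families indexed by any (small) type I,
-- characterised by their universal property; equality is ≈ (mutual ≤).

record Quantale : Set₁ where
  infixl 7 _·_
  infix 4 _≤_
  field
    Carrier  : Set
    _≤_      : Carrier → Carrier → Set
    ≤-refl   : ∀ {a} → a ≤ a
    ≤-trans  : ∀ {a b c} → a ≤ b → b ≤ c → a ≤ c
    ⋁        : {I : Set} → (I → Carrier) → Carrier
    ⋁-ub     : ∀ {I} (f : I → Carrier) (i : I) → f i ≤ ⋁ f
    ⋁-least  : ∀ {I} (f : I → Carrier) {b : Carrier} → (∀ i → f i ≤ b) → ⋁ f ≤ b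
    _·_      : Carrier → Carrier → Carrier
    ·-mono   : ∀ {a a' b b'} → a ≤ a' → b ≤ b' → a · b ≤ a' · b'
    ·-assoc  : ∀ a b c → Eq≤ _≤_ ((a · b) · c) (a · (b · c))
    ·-distribˡ : ∀ a {I} (f : I → Carrier) → Eq≤ _≤_ (a · ⋁ f) (⋁ (λ i → a · f i))
    ·-distribʳ : ∀ {I} (f : I → Carrier) a → Eq≤ _≤_ (⋁ f · a) (⋁ (λ i → f i · a))
    one      : Carrier
    ·-identityˡ : ∀ a → Eq≤ _≤_ (one · a) a
    ·-identityʳ : ∀ a → Eq≤ _≤_ (a · one) a

  infix 4 _≈_
  _≈_ : Carrier → Carrier → Set
  _≈_ = Eq≤ _≤_

record Module (Q : Quantale) : Set₁ where
  private module Q = Quantale Q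
  infixr 7 _*_
  infix 4 _≤_
  field
    Carrier  : Set
    _≤_      : Carrier → Carrier → Set
    ≤-refl   : ∀ {u} → u ≤ u
    ≤-trans  : ∀ {u v w} → u ≤ v → v ≤ w → u ≤ w
    ⋁        : {I : Set} → (I → Carrier) → Carrier
    ⋁-ub     : ∀ {I} (f : I → Carrier) (i : I) → f i ≤ ⋁ f
    ⋁-least  : ∀ {I} (f : I → Carrier) {v : Carrier} → (∀ i → f i ≤ v) → ⋁ f ≤ v
    _*_      : Q.Carrier → Carrier → Carrier
    *-mono   : ∀ {a b u v} → a Q.≤ b → u ≤ v → a * u ≤ b * v
    *-assoc  : ∀ a b v → Eq≤ _≤_ ((a Q.· b) * v) (a * (b * v))
    *-identity : ∀ v → Eq≤ _≤_ (Q.one * v) v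
    *-distribˡ : ∀ a {I} (f : I → Carrier) → Eq≤ _≤_ (a * ⋁ f) (⋁ (λ i → a * f i))
    *-distribʳ : ∀ {I} (f : I → Q.Carrier) v → Eq≤ _≤_ (Q.⋁ f * v) (⋁ (λ i → f i * v))

  infix 4 _≈_
  _≈_ : Carrier → Carrier → Set
  _≈_ = Eq≤ _≤_

record Hom {Q : Quantale} (M N : Module Q) : Set₁ where
  private
    module M = Module M
    module N = Module N
    module Q = Quantale Q
  field
    fn      : M.Carrier → N.Carrier
    fn-cong : ∀ {u v} → u M.≈ v → fn u N.≈ fn v
    fn-⋁    : ∀ {I} (f : I → M.Carrier) → fn (M.⋁ f) N.≈ N.⋁ (λ i → fn (f i))
    fn-*    : ∀ a v → fn (a M.* v) N.≈ a N.* fn v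

open Hom public

-- Surjective homomorphisms (the epimorphisms of the module category).
Surjective : {Q : Quantale} {A B : Module Q} → Hom A B → Set
Surjective {B = B} e = ∀ b → Σ _ λ a → Module._≈_ B (fn e a) b

Projective : {Q : Quantale} → Module Q → Set₁
Projective {Q} M =
  (A B : Module Q) (e : Hom A B) → Surjective e → (f : Hom M B) →
  Σ (Hom M A) λ g → ∀ v → Module._≈_ B (fn e (fn g v)) (fn f v)

Iso : {Q : Quantale} → Module Q → Module Q → Set₁
Iso M N =
  Σ (Hom M N) λ f → Σ (Hom N M) λ g →
    (∀ v → Module._≈_ M (fn g (fn f v)) v) × (∀ w → Module._≈_ N (fn f (fn g w)) w)

Free : (Q : Quantale) → Set → Module Q
Free Q X = record
  { Carrier = X → Q.Carrier
  ; _≤_ = λ f g → ∀ x → f x Q.≤ g x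
  ; ≤-refl = λ x → Q.≤-refl
  ; ≤-trans = λ p q x → Q.≤-trans (p x) (q x)
  ; ⋁ = λ F x → Q.⋁ (λ i → F i x)
  ; ⋁-ub = λ F i x → Q.⋁-ub (λ i → F i x) i
  ; ⋁-least = λ F p x → Q.⋁-least (λ i → F i x) (λ i → p i x)
  ; _*_ = λ a f x → a Q.· f x
  ; *-mono = λ p q x → Q.·-mono p (q x)
  ; *-assoc = λ a b v → (λ x → proj₁ (Q.·-assoc a b (v x))) , (λ x → proj₂ (Q.·-assoc a b (v x)))
  ; *-identity = λ v → (λ x → proj₁ (Q.·-identityˡ (v x))) , (λ x → proj₂ (Q.·-identityˡ (v x)))
  ; *-distribˡ = λ a F → (λ x → proj₁ (Q.·-distribˡ a (λ i → F i x))) , (λ x → proj₂ (Q.·-distribˡ a (λ i → F i x)))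
  ; *-distribʳ = λ F v → (λ x → proj₁ (Q.·-distribʳ F (v x))) , (λ x → proj₂ (Q.·-distribʳ F (v x)))
  }
  where module Q = Quantale Q

Sub : {Q : Quantale} (M : Module Q) (P : Module.Carrier M → Set) →
      (∀ {I} (f : I → Module.Carrier M) → (∀ i → P (f i)) → P (Module.⋁ M f)) →
      (∀ a v → P v → P (Module._*_ M a v)) → Module Q
Sub M P P-⋁ P-* = record
  { Carrier = Σ M.Carrier P
  ; _≤_ = λ u v → proj₁ u M.≤ proj₁ v
  ; ≤-refl = M.≤-refl
  ; ≤-trans = M.≤-trans
  ; ⋁ = λ f → M.⋁ (λ i → proj₁ (f i)) , P-⋁ _ (λ i → proj₂ (f i))
  ; ⋁-ub = λ f i → M.⋁-ub (λ i → proj₁ (f i)) i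
  ; ⋁-least = λ f p → M.⋁-least (λ i → proj₁ (f i)) p
  ; _*_ = λ a v → a M.* proj₁ v , P-* a (proj₁ v) (proj₂ v)
  ; *-mono = M.*-mono
  ; *-assoc = λ a b v → M.*-assoc a b (proj₁ v)
  ; *-identity = λ v → M.*-identity (proj₁ v)
  ; *-distribˡ = λ a f → M.*-distribˡ a (λ i → proj₁ (f i))
  ; *-distribʳ = λ f v → M.*-distribʳ f (proj₁ v)
  }
  where module M = Module M

-- The submodule generated by a family g : J → M.  Since Q is unital,
-- it consists exactly of the elements  ⋁_{j ∈ J} a_j * g_j  (a : J → Q).

module _ {Q : Quantale} (M : Module Q) {J : Set} (g : J → Module.Carrier M) where
  private
    module Q = Quantale Q
    module M = Module M

  InSpan : M.Carrier → Set
  InSpan v = Σ (J → Q.Carrier) λ a → v M.≈ M.⋁ (λ j → a j M.* g j)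

  InSpan-⋁ : ∀ {I} (f : I → M.Carrier) → (∀ i → InSpan (f i)) → InSpan (M.⋁ f)
  InSpan-⋁ f p = a' , le , ge
    where
      a : _ → J → Q.Carrier
      a i = proj₁ (p i)
      a' : J → Q.Carrier
      a' j = Q.⋁ (λ i → a i j)
      rhs = M.⋁ (λ j → a' j M.* g j)
      le : M.⋁ f M.≤ rhs
      le = M.⋁-least f λ i → M.≤-trans (proj₁ (proj₂ (p i)))
             (M.⋁-least _ λ j → M.≤-trans
                (M.*-mono (Q.⋁-ub (λ i → a i j) i) M.≤-refl)
                (M.⋁-ub (λ j → a' j M.* g j) j))
      ge : rhs M.≤ M.⋁ f
      ge = M.⋁-least _ λ j → M.≤-trans (proj₁ (M.*-distribʳ (λ i → a i j) (g j)))
             (M.⋁-least _ λ i → M.≤-trans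
               (M.⋁-ub (λ j → a i j M.* g j) j)
               (M.≤-trans (proj₂ (proj₂ (p i))) (M.⋁-ub f i)))

  InSpan-* : ∀ b v → InSpan v → InSpan (b M.* v)
  InSpan-* b v (a , v≤ , ≤v) = (λ j → b Q.· a j) , le , ge
    where
      le : b M.* v M.≤ M.⋁ (λ j → (b Q.· a j) M.* g j)
      le = M.≤-trans (M.*-mono Q.≤-refl v≤)
             (M.≤-trans (proj₁ (M.*-distribˡ b _))
               (M.⋁-least _ λ j → M.≤-trans (proj₂ (M.*-assoc b (a j) (g j)))
                 (M.⋁-ub (λ j → (b Q.· a j) M.* g j) j)))
      ge : M.⋁ (λ j → (b Q.· a j) M.* g j) M.≤ b M.* v
      ge = M.⋁-least _ λ j → M.≤-trans (proj₁ (M.*-assoc b (a j) (g j)))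
             (M.*-mono Q.≤-refl (M.≤-trans (M.⋁-ub (λ j → a j M.* g j) j) ≤v))

  Span : Module Q
  Span = Sub M InSpan InSpan-⋁ InSpan-*

Generates : {Q : Quantale} (M : Module Q) → (Module.Carrier M → Set) → Set
Generates M X = ∀ v → InSpan M {Σ (Module.Carrier M) X} (λ x → proj₁ x) v

_⋆_ : {Q : Quantale} {X : Set} →
      (X → X → Quantale.Carrier Q) → (X → X → Quantale.Carrier Q) →
      X → X → Quantale.Carrier Q
_⋆_ {Q} h k x y = Quantale.⋁ Q (λ z → Quantale._·_ Q (h x z) (k z y))

Idempotent : {Q : Quantale} {X : Set} → (X → X → Quantale.Carrier Q) → Set
Idempotent {Q} k = ∀ x y → Quantale._≈_ Q (_⋆_ {Q} k k x y) (k x y)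

module Submission where

-- A module M is projective iff it is a retract of a free module; the
-- theorem is this fact made concrete for the free module Q^X on a
-- generating set X ⊆ M.
--
-- (⇒) Since X generates M, the linear extension e : Q^X → M of the
--     inclusion X ⊆ M is surjective, so projectivity lifts id_M to a
--     section s of e.  The rows k(x,_) = s(x) form an idempotent matrix,
--     and s corestricts to an isomorphism of M with the span of the rows
--     (`split-iso`).  This part only uses that e ∘ s = id.
-- (⇐) Free modules are projective (`free-projective`), retracts of
--     projectives are projective (`retract-projective`), and for an
--     idempotent k the span of its rows is a retract of Q^X via
--     t ↦ ⋁_y t(y) * k(y,_) (`span-retract`).  An isomorphism is in
--     particular a retraction, so M is a retract of Q^X.

open import Defs
open import Level using (0ℓ)
open import Data.Product using (Σ; _×_; _,_; proj₁; proj₂)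
open import Function.Bundles using (_⇔_; mk⇔)
open import Relation.Binary.Bundles using (Setoid)
open import Relation.Binary.PropositionalEquality using (_≡_; refl)
import Relation.Binary.Reasoning.Setoid as SetoidReasoning

Eq≤-setoid : {A : Set} (_≤_ : A → A → Set) →
  (∀ {a} → a ≤ a) → (∀ {a b c} → a ≤ b → b ≤ c → a ≤ c) → Setoid 0ℓ 0ℓ
Eq≤-setoid {A} _≤_ ≤-refl ≤-trans = record
  { Carrier = A
  ; _≈_ = Eq≤ _≤_
  ; isEquivalence = record
    { refl = ≤-refl , ≤-refl
    ; sym = λ { (p , q) → q , p }
    ; trans = λ { (p , q) (p' , q') → ≤-trans p p' , ≤-trans q' q }
    }
  }

module ModuleProperties {Q : Quantale} (M : Module Q) where
  open Module M
  private module Q = Quantale Q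

  setoid : Setoid 0ℓ 0ℓ
  setoid = Eq≤-setoid _≤_ ≤-refl ≤-trans

  open Setoid setoid public
    using () renaming (refl to ≈-refl; sym to ≈-sym; trans to ≈-trans)
  open SetoidReasoning setoid public

  ⋁-mono : ∀ {I} {f g : I → Carrier} → (∀ i → f i ≤ g i) → ⋁ f ≤ ⋁ g
  ⋁-mono {f = f} {g} p = ⋁-least f (λ i → ≤-trans (p i) (⋁-ub g i))

  ⋁-cong : ∀ {I} {f g : I → Carrier} → (∀ i → f i ≈ g i) → ⋁ f ≈ ⋁ g
  ⋁-cong p = ⋁-mono (λ i → proj₁ (p i)) , ⋁-mono (λ i → proj₂ (p i))

  *-congˡ : ∀ a {u v} → u ≈ v → a * u ≈ a * v
  *-congˡ a (p , q) = *-mono Q.≤-refl p , *-mono Q.≤-refl q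

  ⋁-swap-≤ : ∀ {I J} (f : I → J → Carrier) →
    ⋁ (λ i → ⋁ (λ j → f i j)) ≤ ⋁ (λ j → ⋁ (λ i → f i j))
  ⋁-swap-≤ f = ⋁-least _ λ i → ⋁-least _ λ j →
    ≤-trans (⋁-ub (λ i → f i j) i) (⋁-ub (λ j → ⋁ (λ i → f i j)) j)

  ⋁-swap : ∀ {I J} (f : I → J → Carrier) →
    ⋁ (λ i → ⋁ (λ j → f i j)) ≈ ⋁ (λ j → ⋁ (λ i → f i j))
  ⋁-swap f = ⋁-swap-≤ f , ⋁-swap-≤ (λ j i → f i j)

module MP = ModuleProperties

module _ {Q : Quantale} where

  idH : {A : Module Q} → Hom A A
  idH {A} = record
    { fn = λ v → v
    ; fn-cong = λ p → p
    ; fn-⋁ = λ _ → MP.≈-refl A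
    ; fn-* = λ _ _ → MP.≈-refl A
    }

  infixr 9 _∘H_
  _∘H_ : {A B C : Module Q} → Hom B C → Hom A B → Hom A C
  _∘H_ {C = C} g f = record
    { fn = λ v → fn g (fn f v)
    ; fn-cong = λ p → fn-cong g (fn-cong f p)
    ; fn-⋁ = λ F → MP.≈-trans C (fn-cong g (fn-⋁ f F)) (fn-⋁ g _)
    ; fn-* = λ a v → MP.≈-trans C (fn-cong g (fn-* f a v)) (fn-* g a (fn f v))
    }

  hom-lin : {A B : Module Q} (h : Hom A B) {I : Set}
    (c : I → Quantale.Carrier Q) (u : I → Module.Carrier A) →
    Module._≈_ B (fn h (Module.⋁ A (λ i → Module._*_ A (c i) (u i))))
                 (Module.⋁ B (λ i → Module._*_ B (c i) (fn h (u i))))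
  hom-lin {B = B} h c u = MP.≈-trans B (fn-⋁ h _) (MP.⋁-cong B (λ i → fn-* h (c i) (u i)))

module FreeModule (Q : Quantale) (Y : Set) where
  private
    module Q = Quantale Q
    F : Module Q
    F = Free Q Y
    module F = Module F

  pointwise : {s t : F.Carrier} → (∀ y → s y Q.≈ t y) → s F.≈ t
  pointwise p = (λ y → proj₁ (p y)) , (λ y → proj₂ (p y))

  linear : (A : Module Q) → (Y → Module.Carrier A) → Hom F A
  linear A u = record
    { fn = λ t → A.⋁ (λ y → t y A.* u y)
    ; fn-cong = λ { (p , q) → ⋁-mono (λ y → A.*-mono (p y) A.≤-refl)
                            , ⋁-mono (λ y → A.*-mono (q y) A.≤-refl) }
    ; fn-⋁ = λ ts → begin
        A.⋁ (λ y → Q.⋁ (λ i → ts i y) A.* u y)  ≈⟨ ⋁-cong (λ y → A.*-distribʳ (λ i → ts i y) (u y)) ⟩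
        A.⋁ (λ y → A.⋁ (λ i → ts i y A.* u y))  ≈⟨ ⋁-swap (λ y i → ts i y A.* u y) ⟩
        A.⋁ (λ i → A.⋁ (λ y → ts i y A.* u y))  ∎
    ; fn-* = λ a t → begin
        A.⋁ (λ y → (a Q.· t y) A.* u y)  ≈⟨ ⋁-cong (λ y → A.*-assoc a (t y) (u y)) ⟩
        A.⋁ (λ y → a A.* (t y A.* u y))  ≈⟨ A.*-distribˡ a _ ⟨
        a A.* A.⋁ (λ y → t y A.* u y)    ∎
    }
    where
      module A = Module A
      open ModuleProperties A

  linear-surjective : (A : Module Q) (u : Y → Module.Carrier A) →
    (∀ v → InSpan A u v) → Surjective (linear A u)
  linear-surjective A u gen v = proj₁ (gen v) , MP.≈-sym A (proj₂ (gen v))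

  -- The unit vectors  δ y = (z ↦ ⋁_{y ≡ z} 1)  form a basis of Q^Y.
  δ : Y → F.Carrier
  δ y z = Q.⋁ {y ≡ z} (λ _ → Q.one)

  expand : (t : F.Carrier) → t F.≈ F.⋁ (λ y → t y F.* δ y)
  expand t = (λ z → below z) , (λ z → above z)
    where
      below : ∀ z → t z Q.≤ Q.⋁ (λ y → t y Q.· δ y z)
      below z = Q.≤-trans (proj₂ (Q.·-identityʳ (t z)))
        (Q.≤-trans (Q.·-mono Q.≤-refl (Q.⋁-ub (λ _ → Q.one) refl))
                   (Q.⋁-ub (λ y → t y Q.· δ y z) z))
      at : ∀ {y z} → y ≡ z → t y Q.· Q.one Q.≤ t z
      at refl = proj₁ (Q.·-identityʳ _)
      above : ∀ z → Q.⋁ (λ y → t y Q.· δ y z) Q.≤ t z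
      above z = Q.⋁-least _ λ y →
        Q.≤-trans (proj₁ (Q.·-distribˡ (t y) (λ _ → Q.one))) (Q.⋁-least _ at)

  -- Q^Y is projective: lift the images of the basis vectors one by one.
  free-projective : Projective F
  free-projective A B e e-surjective f = linear A a , lifts
    where
      open ModuleProperties B
      module B = Module B
      a : Y → Module.Carrier A
      a y = proj₁ (e-surjective (fn f (δ y)))
      lifts : ∀ t → fn e (fn (linear A a) t) B.≈ fn f t
      lifts t = begin
        fn e (fn (linear A a) t)          ≈⟨ hom-lin e t a ⟩
        B.⋁ (λ y → t y B.* fn e (a y))    ≈⟨ ⋁-cong (λ y → *-congˡ (t y) (proj₂ (e-surjective (fn f (δ y))))) ⟩
        B.⋁ (λ y → t y B.* fn f (δ y))    ≈⟨ hom-lin f t δ ⟨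
        fn f (F.⋁ (λ y → t y F.* δ y))    ≈⟨ fn-cong f (expand t) ⟨
        fn f t                            ∎

open FreeModule using (pointwise; linear; linear-surjective; free-projective)

module _ {Q : Quantale} {N : Module Q} {J : Set} {g : J → Module.Carrier N} where

  inclusion : Hom (Span N g) N
  inclusion = record
    { fn = proj₁ ; fn-cong = λ p → p ; fn-⋁ = λ _ → MP.≈-refl N ; fn-* = λ _ _ → MP.≈-refl N }

  corestrict : {M : Module Q} (h : Hom M N) → (∀ v → InSpan N g (fn h v)) → Hom M (Span N g)
  corestrict h inSpan = record
    { fn = λ v → fn h v , inSpan v
    ; fn-cong = fn-cong h
    ; fn-⋁ = fn-⋁ h
    ; fn-* = fn-* h
    }

record Retract {Q : Quantale} (M N : Module Q) : Set₁ where
  field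
    section    : Hom M N
    retraction : Hom N M
    retraction∘section : ∀ v → Module._≈_ M (fn retraction (fn section v)) v

open Retract

iso⇒retract : {Q : Quantale} {M N : Module Q} → Iso M N → Retract M N
iso⇒retract (f , g , g∘f , _) = record { section = f ; retraction = g ; retraction∘section = g∘f }

retract-trans : {Q : Quantale} {L M N : Module Q} → Retract L M → Retract M N → Retract L N
retract-trans {L = L} ρ σ = record
  { section = section σ ∘H section ρ
  ; retraction = retraction ρ ∘H retraction σ
  ; retraction∘section = λ v →
      MP.≈-trans L (fn-cong (retraction ρ) (retraction∘section σ (fn (section ρ) v)))
                (retraction∘section ρ v)
  }

-- A retract of a projective module is projective: lift f ∘ r, then
-- precompose with the section.
retract-projective : {Q : Quantale} {M N : Module Q} → Retract M N → Projective N → Projective M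
retract-projective ρ N-projective A B e e-surjective f
  with N-projective A B e e-surjective (f ∘H retraction ρ)
... | lift , lifts = lift ∘H section ρ , λ v →
  MP.≈-trans B (lifts (fn (section ρ) v)) (fn-cong f (retraction∘section ρ v))

-- The rows of an idempotent matrix k span a retract of Q^Y; the
-- retraction is  t ↦ ⋁_y t(y) * k(y,_),  which fixes every row because
-- k ⋆ k = k, hence fixes the whole span.
span-retract : (Q : Quantale) {Y : Set} (k : Y → Y → Quantale.Carrier Q) →
  Idempotent {Q} k → Retract (Span (Free Q Y) k) (Free Q Y)
span-retract Q {Y} k idem = record
  { section = inclusion
  ; retraction = corestrict combine (λ t → t , ≈-refl)
  ; retraction∘section = fixes
  }
  where
    F : Module Q
    F = Free Q Y
    module F = Module F
    open ModuleProperties F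
    combine : Hom F F
    combine = linear Q Y F k
    fixes : (w : Module.Carrier (Span F k)) → fn combine (proj₁ w) F.≈ proj₁ w
    fixes (w , c , w≈) = begin
      fn combine w                           ≈⟨ fn-cong combine w≈ ⟩
      fn combine (F.⋁ (λ j → c j F.* k j))   ≈⟨ hom-lin combine c k ⟩
      F.⋁ (λ j → c j F.* fn combine (k j))   ≈⟨ ⋁-cong (λ j → *-congˡ (c j) (pointwise Q Y (idem j))) ⟩
      F.⋁ (λ j → c j F.* k j)                ≈⟨ w≈ ⟨
      w                                      ∎

module SplitLinear (Q : Quantale) {Y : Set} (M : Module Q) (u : Y → Module.Carrier M)
  (s : Hom M (Free Q Y)) (split : ∀ v → Module._≈_ M (fn (linear Q Y M u) (fn s v)) v) where
  private
    F : Module Q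
    F = Free Q Y
    module F = Module F
    open ModuleProperties F
    e : Hom F M
    e = linear Q Y M u

  k : Y → Y → Quantale.Carrier Q
  k x = fn s (u x)

  section-in-span : ∀ v → fn s v F.≈ F.⋁ (λ y → fn s v y F.* k y)
  section-in-span v = begin
    fn s v                       ≈⟨ fn-cong s (split v) ⟨
    fn s (fn e (fn s v))         ≈⟨ hom-lin s (fn s v) u ⟩
    F.⋁ (λ y → fn s v y F.* k y) ∎

  k-idempotent : Idempotent {Q} k
  k-idempotent x z = proj₂ row-x z , proj₁ row-x z
    where
      row-x : k x F.≈ F.⋁ (λ y → k x y F.* k y)
      row-x = section-in-span (u x)

  split-iso : Iso M (Span F k)
  split-iso = φ , ψ , split , φ∘ψ
    where
      S : Module Q
      S = Span F k
      φ : Hom M S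
      φ = corestrict s (λ v → fn s v , section-in-span v)
      ψ : Hom S M
      ψ = e ∘H inclusion
      s∘e : Hom F F
      s∘e = s ∘H e
      φ∘ψ : ∀ w → Module._≈_ S (fn φ (fn ψ w)) w
      φ∘ψ (w , c , w≈) = begin
        fn s∘e w                            ≈⟨ fn-cong s∘e w≈ ⟩
        fn s∘e (F.⋁ (λ j → c j F.* k j))    ≈⟨ hom-lin s∘e c k ⟩
        F.⋁ (λ j → c j F.* fn s∘e (k j))    ≈⟨ ⋁-cong (λ j → *-congˡ (c j) (fn-cong s (split (u j)))) ⟩
        F.⋁ (λ j → c j F.* k j)             ≈⟨ w≈ ⟨
        w                                   ∎

theorem2p4 : (Q : Quantale) (M : Module Q) (X : Module.Carrier M → Set) →
    Generates M X →
    Projective M ⇔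
    Σ (Σ (Module.Carrier M) X → Σ (Module.Carrier M) X → Quantale.Carrier Q)
    (λ k → Idempotent {Q} k × Iso M (Span (Free Q (Σ (Module.Carrier M) X)) (λ x → k x)))
theorem2p4 Q M X generates = mk⇔ projective⇒split projective⇐split
  where
    Y : Set
    Y = Σ (Module.Carrier M) X
    e : Hom (Free Q Y) M
    e = linear Q Y M proj₁
    Splitting : Set₁
    Splitting = Σ (Y → Y → Quantale.Carrier Q)
      (λ k → Idempotent {Q} k × Iso M (Span (Free Q Y) (λ x → k x)))

    projective⇒split : Projective M → Splitting
    projective⇒split M-projective = k , k-idempotent , split-iso
      where
        section-of-e : Σ (Hom M (Free Q Y)) λ s → ∀ v → Module._≈_ M (fn e (fn s v)) v
        section-of-e = M-projective (Free Q Y) M e (linear-surjective Q Y M proj₁ generates) idH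
        open SplitLinear Q M proj₁ (proj₁ section-of-e) (proj₂ section-of-e)

    projective⇐split : Splitting → Projective M
    projective⇐split (k , idem , iso) =
      retract-projective (retract-trans (iso⇒retract iso) (span-retract Q k idem))
                         (free-projective Q Y)
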